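{- Let $A$ be a finite nonempty alphabet and let $S\subset A^*$ be a tree set. For every $w\in S$, every finite $S$-maximal suffix code $U\subset S$ and every finite $S$-maximal prefix code $V\subset S$, the generalized extension graph $E_{U,V}(w)$ is a tree.
   Context: $S$ is factorial if it contains all factors of its elements. For $w\in S$: $L(w)=\{a\in A\mid aw\in S\}$, $R(w)=\{a\in A\mid wa\in S\}$, $E(w)=\{(a,b)\mid awb\in S\}$; $S$ is biextendable if factorial and $E(w)\ne\emptyset$ for all $w$. The extension graph of $w$ is the undirected bipartite graph with vertex set the disjoint union of $L(w)$ and $R(w)$ and an edge $a$–$b$ for each $(a,b)\in E(w)$; $S$ is a tree set if biextendable and all extension graphs are trees. A prefix code (resp. suffix code) is a set of nonempty words containing no proper prefix (resp. proper suffix) of any of its elements; a prefix code $X\subset S$ is $S$-maximal if it is not properly contained in any prefix code $Y\subset S$, and similarly for suffix codes. For $w\in S$ and sets of words $U,V$, $U(w)=\{u\in U\mid uw\in S\}$, $V(w)=\{r\in V\mid wr\in S\}$; the generalized extension graph $E_{U,V}(w)$ is the undirected graph with vertex set the disjoint union of copies of $U(w)$ and $V(w)$ and an edge $(u,r)$ whenever $uwr\in S$. -}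

module Defs where

open import Data.Nat using (ℕ; suc; _≥_)
open import Data.Fin using (Fin)
open import Data.List using (List; []; _∷_; _++_; [_]; length)
open import Data.List.Membership.Propositional using (_∈_)
open import Data.List.Relation.Unary.Unique.Propositional using (Unique)
open import Data.List.Relation.Unary.Linked using (Linked)
open import Data.List.Relation.Unary.All using (All)
open import Data.List.Relation.Unary.Any using (Any)
open import Data.Product using (Σ; ∃; ∃-syntax; _×_; _,_)
open import Data.Sum using (_⊎_; inj₁; inj₂)
open import Relation.Binary.PropositionalEquality using (_≡_; _≢_)
open import Relation.Nullary using (¬_)

Word : Set → Set
Word A = List A

WordSet : Set → Set₁
WordSet A = Word A → Set

_⊆_ : {A : Set} → WordSet A → WordSet A → Set
X ⊆ Y = ∀ x → X x → Y x

NonEmptyWord : {A : Set} → Word A → Set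
NonEmptyWord w = w ≢ []

Factorial : {A : Set} → WordSet A → Set
Factorial {A} S = ∀ (u v x : Word A) → S (u ++ v ++ x) → S v

Biextendable : {A : Set} → WordSet A → Set
Biextendable {A} S =
  Factorial S × (∀ (w : Word A) → S w → ∃[ a ] ∃[ b ] S (a ∷ w ++ [ b ]))

-- Undirected graphs: vertex type V, vertex predicate Vtx, adjacency Adj
-- (we only use symmetric Adj).  Vertices are compared by ≡ on V.

record Graph (V : Set) : Set₁ where
  field
    Vtx : V → Set
    Adj : V → V → Set

module _ {V : Set} (G : Graph V) where
  open Graph G

  data Walk : V → V → Set where
    here : ∀ {x} → Vtx x → Walk x x
    step : ∀ {x y z} → Vtx x → Adj x y → Walk y z → Walk x z

  Connected : Set
  Connected = ∀ x y → Vtx x → Vtx y → Walk x y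

  last : V → List V → V
  last x []       = x
  last x (y ∷ ys) = last y ys

  -- a cycle: pairwise distinct vertices v₀ … vₖ (k ≥ 2, i.e. at least 3
  -- vertices), consecutive ones adjacent and vₖ adjacent to v₀
  record Cycle : Set where
    field
      v₀     : V
      rest   : List V
      long   : length rest ≥ 2
      inG    : All Vtx (v₀ ∷ rest)
      dist   : Unique (v₀ ∷ rest)
      linked : Linked Adj (v₀ ∷ rest)
      closes : Adj (last v₀ rest) v₀

  Acyclic : Set
  Acyclic = ¬ Cycle

  IsTree : Set
  IsTree = (∃[ x ] Vtx x) × Connected × Acyclic

-- Extension graph of w: vertices L(w) ⊎ R(w) (disjoint copies of A)

ExtGraph : {A : Set} → WordSet A → Word A → Graph (A ⊎ A)
ExtGraph S w = record { Vtx = vtx ; Adj = adj }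
  where
  vtx : _ → Set
  vtx (inj₁ a) = S (a ∷ w)
  vtx (inj₂ b) = S (w ++ [ b ])
  adj : _ → _ → Set
  adj (inj₁ a) (inj₂ b) = S (a ∷ w ++ [ b ])
  adj (inj₂ b) (inj₁ a) = S (a ∷ w ++ [ b ])
  adj _ _ = Data.Empty.⊥
    where import Data.Empty

TreeSet : {A : Set} → WordSet A → Set
TreeSet S = Biextendable S × (∀ w → S w → IsTree (ExtGraph S w))

PrefixCode : {A : Set} → WordSet A → Set
PrefixCode {A} X =
  (∀ x → X x → NonEmptyWord x) ×
  (∀ x y (z : Word A) → X x → X y → NonEmptyWord z → y ≡ x ++ z → Data.Empty.⊥)
  where import Data.Empty

SuffixCode : {A : Set} → WordSet A → Set
SuffixCode {A} X =
  (∀ x → X x → NonEmptyWord x) ×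
  (∀ x y (z : Word A) → X x → X y → NonEmptyWord z → y ≡ z ++ x → Data.Empty.⊥)
  where import Data.Empty

SMaximalPrefixCode : {A : Set} → WordSet A → WordSet A → Set₁
SMaximalPrefixCode S X =
  X ⊆ S × PrefixCode X ×
  (∀ Y → PrefixCode Y → Y ⊆ S → ¬ (X ⊆ Y × ∃[ y ] (Y y × ¬ X y)))

SMaximalSuffixCode : {A : Set} → WordSet A → WordSet A → Set₁
SMaximalSuffixCode S X =
  X ⊆ S × SuffixCode X ×
  (∀ Y → SuffixCode Y → Y ⊆ S → ¬ (X ⊆ Y × ∃[ y ] (Y y × ¬ X y)))

-- a finite set of words given by a list
⟦_⟧ : {A : Set} → List (Word A) → WordSet A
⟦ U ⟧ u = u ∈ U

GenExtGraph : {A : Set} → WordSet A → WordSet A → WordSet A → Word A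
            → Graph (Word A ⊎ Word A)
GenExtGraph S U V w = record { Vtx = vtx ; Adj = adj }
  where
  vtx : _ → Set
  vtx (inj₁ u) = U u × S (u ++ w)
  vtx (inj₂ r) = V r × S (w ++ r)
  adj : _ → _ → Set
  adj (inj₁ u) (inj₂ r) = U u × V r × S (u ++ w ++ r)
  adj (inj₂ r) (inj₁ u) = U u × V r × S (u ++ w ++ r)
  adj _ _ = Data.Empty.⊥
    where import Data.Empty

-- Induction on the total length of U.  If U consists of letters, then U = A ∩ S and
-- E_{U,V}(w) is E_{A,V}(w).  Otherwise take a longest word a u of U: replacing a u and all
-- of A u ∩ U by u gives an S-maximal suffix code U′ of smaller total length, and E_{U,V}(w)
-- is E_{U′,V}(w) with the vertex u replaced by a copy of E_{A,V}(u w), which is glued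
-- along the right vertices.  Gluing a tree into a tree at a vertex gives a tree.  The case
-- U = A is the mirror image, for the reversal of S, of the case V = A, which reduces in
-- the same way to the extension graphs E_{A,A}(w) of the tree set S.

module Submission where

open import Defs
open import Data.Nat using (ℕ; suc; zero; _≤_; _≤?_; _+_; _≥_; z≤n; s≤s)
open import Data.Nat.Properties
  using (≤-refl; ≤-trans; ≤-reflexive; ≤-pred; 1+n≰n; ≰⇒≥; +-monoʳ-≤; m≤n+m;
         +-commutativeSemigroup)
open import Algebra.Properties.CommutativeSemigroup +-commutativeSemigroup using (x∙yz≈y∙xz)
open import Data.Fin using (Fin)
import Data.Fin.Properties as Fin
open import Data.List using (List; []; _∷_; _++_; [_]; length; map; filter; reverse)
open import Data.List.Properties
  using (++-assoc; ++-identityʳ; ++-identityˡ-unique; ++-conicalʳ; length-map; length-++-≤ʳ;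
         length-++-sucʳ; length-++-comm; ≡-dec; ∷-injectiveʳ; map-++; reverse-++; reverse-involutive)
open import Data.List.Membership.Propositional using (_∈_; find; lose)
open import Data.List.Membership.Propositional.Properties
  using (∈-∃++; ∈-++⁺ʳ; ∈-filter⁺; ∈-filter⁻; ∈-map⁺; ∈-map⁻)
open import Data.List.Relation.Binary.Disjoint.Propositional using (Disjoint)
open import Data.List.Relation.Unary.Any using (Any; here; there; any?)
open import Data.List.Relation.Unary.All as All using (All; []; _∷_)
import Data.List.Relation.Unary.All.Properties as All
open import Data.List.Relation.Unary.Linked as Linked using (Linked; []; [-]; _∷_)
import Data.List.Relation.Unary.Linked.Properties as Linked
open import Data.List.Relation.Unary.Unique.Propositional using (Unique)
import Data.List.Relation.Unary.Unique.Propositional.Properties as Unique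
open import Data.List.Relation.Unary.AllPairs using ([]; _∷_)
open import Data.Product using (Σ; ∃; ∃-syntax; _×_; _,_; proj₁; proj₂)
open import Data.Sum using (_⊎_; inj₁; inj₂)
open import Data.Empty using (⊥; ⊥-elim)
open import Data.Unit using (⊤; tt)
open import Function using (id; _∘′_; case_of_)
open import Relation.Binary.Definitions using (DecidableEquality)
open import Relation.Binary.PropositionalEquality
  using (_≡_; _≢_; refl; sym; trans; cong; cong₂; subst; subst₂)
open import Relation.Nullary using (¬_; Dec; yes; no; ¬?)
open import Relation.Nullary.Decidable using (decidable-stable)

module _ {X : Set} where

  unique-++⁻ : ∀ xs {ys : List X} → Unique (xs ++ ys) → Unique xs × Unique ys × Disjoint xs ys
  unique-++⁻ [] u = [] , u , λ ()
  unique-++⁻ (x ∷ xs) (x∉ ∷ u) with unique-++⁻ xs u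
  ... | uxs , uys , disj =
    All.++⁻ˡ xs x∉ ∷ uxs , uys ,
    λ { (here refl , j) → All.lookup (All.++⁻ʳ xs x∉) j refl ; (there i , j) → disj (i , j) }

  unique-rotate : ∀ xs {ys : List X} → Unique (xs ++ ys) → Unique (ys ++ xs)
  unique-rotate xs u with unique-++⁻ xs u
  ... | uxs , uys , disj = Unique.++⁺ uys uxs λ (i , j) → disj (j , i)

  unique-dropMiddle : ∀ xs ys {zs : List X} → Unique (xs ++ ys ++ zs) → Unique (xs ++ zs)
  unique-dropMiddle xs ys u with unique-++⁻ xs u
  ... | uxs , uyzs , disj = Unique.++⁺ uxs (proj₁ (proj₂ (unique-++⁻ ys uyzs)))
                              λ (i , j) → disj (i , ∈-++⁺ʳ ys j)

  unique-map⁺ : ∀ {Y : Set} {P : X → Set} (f : X → Y) →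
    (∀ {x y} → P x → P y → f x ≡ f y → x ≡ y) →
    ∀ {xs} → All P xs → Unique xs → Unique (map f xs)
  unique-map⁺ f inj [] [] = []
  unique-map⁺ {P = P} f inj {x ∷ _} (px ∷ pxs) (x∉ ∷ u) = distinct pxs x∉ ∷ unique-map⁺ f inj pxs u
    where
    distinct : ∀ {ys} → All P ys → All (x ≢_) ys → All (f x ≢_) (map f ys)
    distinct [] [] = []
    distinct (py ∷ pys) (x≢y ∷ x≢ys) = (λ e → x≢y (inj px py e)) ∷ distinct pys x≢ys

module _ {X : Set} {R : X → X → Set} where

  linked-split : ∀ xs a {ys} → Linked R (xs ++ a ∷ ys) → Linked R (xs ++ [ a ]) × Linked R (a ∷ ys)
  linked-split [] a l = [-] , l
  linked-split (x ∷ []) a (r ∷ l) = r ∷ [-] , l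
  linked-split (x ∷ x′ ∷ xs) a (r ∷ l) with linked-split (x′ ∷ xs) a l
  ... | l₁ , l₂ = r ∷ l₁ , l₂

  linked-join : ∀ xs a {ys} → Linked R (xs ++ [ a ]) → Linked R (a ∷ ys) → Linked R (xs ++ a ∷ ys)
  linked-join [] a _ l = l
  linked-join (x ∷ []) a (r ∷ _) l = r ∷ l
  linked-join (x ∷ x′ ∷ xs) a (r ∷ l₁) l = r ∷ linked-join (x′ ∷ xs) a l₁ l

  linked-dropˡ : ∀ xs {ys} → Linked R (xs ++ ys) → Linked R ys
  linked-dropˡ [] l = l
  linked-dropˡ (x ∷ xs) l = linked-dropˡ xs (Linked.tail l)

  linked-mono : ∀ {R′ : X → X → Set} {P : X → Set} → (∀ {x y} → P x → P y → R x y → R′ x y) →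
    ∀ {xs} → All P xs → Linked R xs → Linked R′ xs
  linked-mono h [] [] = []
  linked-mono h (_ ∷ []) [-] = [-]
  linked-mono h (px ∷ py ∷ pxs) (r ∷ l) = h px py r ∷ linked-mono h (py ∷ pxs) l

module _ {X : Set} {P : X → Set} (P? : ∀ x → Dec (P x)) where

  split-first : ∀ xs → Any P xs →
    ∃[ as ] ∃[ d ] ∃[ bs ] xs ≡ as ++ d ∷ bs × All (¬_ ∘′ P) as × P d
  split-first (x ∷ xs) (here p) = [] , x , xs , refl , [] , p
  split-first (x ∷ xs) (there i) with P? x
  ... | yes p = [] , x , xs , refl , [] , p
  ... | no ¬p with split-first xs i
  ...   | as , d , bs , refl , ¬as , pd = x ∷ as , d , bs , refl , ¬p ∷ ¬as , pd

  split-last : ∀ xs → Any P xs →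
    ∃[ ms ] ∃[ d ] ∃[ es ] xs ≡ ms ++ d ∷ es × P d × All (¬_ ∘′ P) es
  split-last (x ∷ xs) i with any? P? xs
  ... | yes j with split-last xs j
  ...   | ms , d , es , refl , pd , ¬es = x ∷ ms , d , es , refl , pd , ¬es
  split-last (x ∷ xs) (here p)  | no ¬any = [] , x , xs , refl , p , All.¬Any⇒All¬ xs ¬any
  split-last (x ∷ xs) (there j) | no ¬any = ⊥-elim (¬any j)

-- Graphs

_++ʷ_ : ∀ {X : Set} {G : Graph X} {x y z} → Walk G x y → Walk G y z → Walk G x z
here _ ++ʷ q = q
step v a p ++ʷ q = step v a (p ++ʷ q)

module _ {X : Set} (G : Graph X) where
  open Graph G

  -- A cycle with its closing edge recorded as the last link of the list.
  record ClosedCycle : Set where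
    field
      start  : X
      rest   : List X
      long   : length rest ≥ 2
      inG    : All Vtx (start ∷ rest)
      dist   : Unique (start ∷ rest)
      linked : Linked Adj (start ∷ rest ++ [ start ])

  private
    linked-close : ∀ x xs y → Linked Adj (x ∷ xs) → Adj (last G x xs) y → Linked Adj (x ∷ xs ++ [ y ])
    linked-close x [] y [-] r = r ∷ [-]
    linked-close x (z ∷ zs) y (r ∷ l) c = r ∷ linked-close z zs y l c

    linked-open : ∀ x xs y → Linked Adj (x ∷ xs ++ [ y ]) → Linked Adj (x ∷ xs) × Adj (last G x xs) y
    linked-open x [] y (r ∷ [-]) = [-] , r
    linked-open x (z ∷ zs) y (r ∷ l) with linked-open z zs y l
    ... | l′ , c = r ∷ l′ , c

  toClosedCycle : Cycle G → ClosedCycle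
  toClosedCycle c = record
    { start = v₀ ; rest = rest ; long = long ; inG = inG ; dist = dist
    ; linked = linked-close v₀ rest v₀ linked closes }
    where open Cycle c

  fromClosedCycle : ClosedCycle → Cycle G
  fromClosedCycle c = record
    { v₀ = start ; rest = rest ; long = long ; inG = inG ; dist = dist
    ; linked = proj₁ (linked-open start rest start linked)
    ; closes = proj₂ (linked-open start rest start linked) }
    where open ClosedCycle c

  rotate : (C : ClosedCycle) → ∀ {x} → x ∈ ClosedCycle.start C ∷ ClosedCycle.rest C →
           Σ ClosedCycle λ C′ → ClosedCycle.start C′ ≡ x
  rotate C x∈ with ∈-∃++ x∈
  ... | [] , _ , refl = C , refl
  rotate record { start = s ; long = long ; inG = inG ; dist = dist ; linked = linked } {x} _
      | _ ∷ p , q , refl =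
    record { start = x ; rest = q ++ s ∷ p ; long = long′ ; inG = inG′
           ; dist = unique-rotate (s ∷ p) dist ; linked = linked′ } , refl
    where
    long′ : length (q ++ s ∷ p) ≥ 2
    long′ = ≤-trans long (≤-reflexive (trans (length-++-comm p (x ∷ q)) (sym (length-++-sucʳ q s p))))
    inG′ : All Vtx (x ∷ q ++ s ∷ p)
    inG′ = All.++⁺ (All.++⁻ʳ (s ∷ p) inG) (All.++⁻ˡ (s ∷ p) inG)
    linked′ : Linked Adj (x ∷ (q ++ s ∷ p) ++ [ x ])
    linked′ with linked-split (s ∷ p) x (subst (Linked Adj) (cong (s ∷_) (++-assoc p (x ∷ q) [ s ])) linked)
    ... | l₁ , l₂ = subst (Linked Adj) (cong (x ∷_) (sym (++-assoc q (s ∷ p) [ x ])))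
                      (linked-join (x ∷ q) s l₂ l₁)

record Hom {X Y : Set} (G : Graph X) (H : Graph Y) : Set where
  field
    fun : X → Y
    vtx : ∀ {x} → Graph.Vtx G x → Graph.Vtx H (fun x)
    adj : ∀ {x y} → Graph.Adj G x y → Graph.Adj H (fun x) (fun y)

module _ {X Y : Set} {G : Graph X} {H : Graph Y} (f : Hom G H) where
  open Hom f

  mapWalk : ∀ {x y} → Walk G x y → Walk H (fun x) (fun y)
  mapWalk (here v) = here (vtx v)
  mapWalk (step v a p) = step (vtx v) (adj a) (mapWalk p)

  mapClosedCycle : (∀ {x y} → Graph.Vtx G x → Graph.Vtx G y → fun x ≡ fun y → x ≡ y) →
                   ClosedCycle G → ClosedCycle H
  mapClosedCycle inj C = record
    { start = fun start ; rest = map fun rest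
    ; long = ≤-trans long (≤-reflexive (sym (length-map fun rest)))
    ; inG = All.map⁺ (All.map vtx inG)
    ; dist = unique-map⁺ fun inj inG dist
    ; linked = subst (Linked (Graph.Adj H)) (cong (fun start ∷_) (map-++ fun rest [ start ]))
                 (Linked.map⁺ (Linked.map adj linked)) }
    where open ClosedCycle C

IsTree-retract : ∀ {X Y : Set} {G : Graph X} {H : Graph Y} (f : Hom G H) (g : Hom H G) →
  (∀ {y} → Graph.Vtx H y → Hom.fun f (Hom.fun g y) ≡ y) → IsTree G → IsTree H
IsTree-retract {G = G} {H} f g fg ((x , vx) , connected , acyclic) =
  (fun f x , vtx f vx) ,
  (λ y y′ vy vy′ → subst₂ (Walk H) (fg vy) (fg vy′) (mapWalk f (connected _ _ (vtx g vy) (vtx g vy′)))) ,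
  λ c → acyclic (fromClosedCycle G (mapClosedCycle g g-injective (toClosedCycle H c)))
  where
  open Hom
  g-injective : ∀ {y y′} → Graph.Vtx H y → Graph.Vtx H y′ → fun g y ≡ fun g y′ → y ≡ y′
  g-injective vy vy′ e = trans (sym (fg vy)) (trans (cong (fun f) e) (fg vy′))

linked-vertices : ∀ {X : Set} {G : Graph X} → (∀ {x y} → Graph.Adj G x y → Graph.Vtx G x) →
  ∀ xs {y} → Linked (Graph.Adj G) (xs ++ [ y ]) → All (Graph.Vtx G) xs
linked-vertices adj⇒vtx [] _ = []
linked-vertices adj⇒vtx (x ∷ []) (a ∷ _) = adj⇒vtx a ∷ []
linked-vertices adj⇒vtx (x ∷ x′ ∷ xs) (a ∷ l) = adj⇒vtx a ∷ linked-vertices adj⇒vtx (x′ ∷ xs) l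

-- Words and generalized extension graphs

Letter : {A : Set} → WordSet A
Letter [] = ⊥
Letter (_ ∷ []) = ⊤
Letter (_ ∷ _ ∷ _) = ⊥

-- LeftExtension u is the set A u of the paper.
LeftExtension : {A : Set} → Word A → WordSet A
LeftExtension u [] = ⊥
LeftExtension u (_ ∷ x) = x ≡ u

leftExtension⇒≡ : ∀ {A : Set} {u : Word A} x → LeftExtension u x → ∃[ b ] x ≡ b ∷ u
leftExtension⇒≡ (b ∷ x) refl = b , refl

totalLength : {A : Set} → List (Word A) → ℕ
totalLength [] = 0
totalLength (x ∷ xs) = length x + totalLength xs

Suffix : {A : Set} → Word A → Word A → Set
Suffix u x = ∃[ z ] x ≡ z ++ u

ProperSuffix : {A : Set} → Word A → Word A → Set
ProperSuffix x u = ∃[ a ] ∃[ z ] u ≡ a ∷ z ++ x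

≢-++-self : ∀ {A : Set} (x z : Word A) → z ≢ [] → x ≢ z ++ x
≢-++-self x z z≢[] e = z≢[] (++-identityˡ-unique z e)

factorˡ : ∀ {A : Set} {S : WordSet A} → Factorial S → ∀ p v → S (p ++ v) → S v
factorˡ {S = S} fac p v s = fac p v [] (subst S (cong (p ++_) (sym (++-identityʳ v))) s)

factorʳ : ∀ {A : Set} {S : WordSet A} → Factorial S → ∀ v q → S (v ++ q) → S v
factorʳ fac = fac []

module _ {A : Set} {S : WordSet A} (fac : Factorial S) {U V : WordSet A} {w : Word A} where

  GenExtGraph-vtx⇒S : ∀ {p} → Graph.Vtx (GenExtGraph S U V w) p → S w
  GenExtGraph-vtx⇒S {inj₁ x} (_ , s) = factorˡ fac x w s
  GenExtGraph-vtx⇒S {inj₂ r} (_ , s) = factorʳ fac w r s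

  GenExtGraph-adj⇒vtx : ∀ {p q} → Graph.Adj (GenExtGraph S U V w) p q → Graph.Vtx (GenExtGraph S U V w) p
  GenExtGraph-adj⇒vtx {inj₁ x} {inj₂ r} (x∈U , _ , s) =
    x∈U , factorʳ fac (x ++ w) r (subst S (sym (++-assoc x w r)) s)
  GenExtGraph-adj⇒vtx {inj₂ r} {inj₁ x} (_ , r∈V , s) = r∈V , factorˡ fac x (w ++ r) s

_≐_within_ : {A : Set} → WordSet A → WordSet A → WordSet A → Set
U ≐ U′ within S = ∀ x → S x → (U x → U′ x) × (U′ x → U x)

GenExtGraph-IsTree-resp : ∀ {A : Set} {S U U′ V V′ : WordSet A} {w} → Factorial S →
  U ≐ U′ within S → V ≐ V′ within S → IsTree (GenExtGraph S U V w) → IsTree (GenExtGraph S U′ V′ w)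
GenExtGraph-IsTree-resp {S = S} {U} {U′} {V} {V′} {w} fac U≐U′ V≐V′ =
  IsTree-retract (identity U≐U′ V≐V′) (identity (flip U≐U′) (flip V≐V′)) λ _ → refl
  where
  flip : ∀ {X Y} → X ≐ Y within S → Y ≐ X within S
  flip X≐Y x sx = proj₂ (X≐Y x sx) , proj₁ (X≐Y x sx)
  identity : ∀ {X X′ Y Y′} → X ≐ X′ within S → Y ≐ Y′ within S →
             Hom (GenExtGraph S X Y w) (GenExtGraph S X′ Y′ w)
  identity {X} {X′} {Y} {Y′} X≐X′ Y≐Y′ =
    record { fun = id ; vtx = λ {p} → vtx p ; adj = λ {p} → adj p }
    where
    E = GenExtGraph S X Y w
    E′ = GenExtGraph S X′ Y′ w
    vtx : ∀ p → Graph.Vtx E p → Graph.Vtx E′ p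
    vtx (inj₁ x) (x∈X , s) = proj₁ (X≐X′ x (factorʳ fac x w s)) x∈X , s
    vtx (inj₂ r) (r∈Y , s) = proj₁ (Y≐Y′ r (factorˡ fac w r s)) r∈Y , s
    X⇒X′ : ∀ x r → S (x ++ w ++ r) → X x → X′ x
    X⇒X′ x r s = proj₁ (X≐X′ x (factorʳ fac x (w ++ r) s))
    Y⇒Y′ : ∀ x r → S (x ++ w ++ r) → Y r → Y′ r
    Y⇒Y′ x r s = proj₁ (Y≐Y′ r (factorˡ fac (x ++ w) r (subst S (sym (++-assoc x w r)) s)))
    adj : ∀ p {q} → Graph.Adj E p q → Graph.Adj E′ p q
    adj (inj₁ x) {inj₂ r} (x∈X , r∈Y , s) = X⇒X′ x r s x∈X , Y⇒Y′ x r s r∈Y , s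
    adj (inj₂ r) {inj₁ x} (x∈X , r∈Y , s) = X⇒X′ x r s x∈X , Y⇒Y′ x r s r∈Y , s

GenExtGraph-Letter-IsTree : ∀ {A : Set} {S : WordSet A} {w} → A →
  IsTree (ExtGraph S w) → IsTree (GenExtGraph S Letter Letter w)
GenExtGraph-Letter-IsTree {A} {S} {w} a₀ = IsTree-retract toWords toLetters toWords∘toLetters
  where
  E = ExtGraph S w
  L = GenExtGraph S Letter Letter w
  -- The default a₀ is only used on [], which is not a vertex of L.
  firstLetter : Word A → A
  firstLetter [] = a₀
  firstLetter (a ∷ _) = a
  toWords : Hom E L
  toWords = record { fun = fun ; vtx = λ {p} → vtx p ; adj = λ {p} → adj p }
    where
    fun : A ⊎ A → Word A ⊎ Word A
    fun (inj₁ a) = inj₁ [ a ]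
    fun (inj₂ b) = inj₂ [ b ]
    vtx : ∀ p → Graph.Vtx E p → Graph.Vtx L (fun p)
    vtx (inj₁ _) s = tt , s
    vtx (inj₂ _) s = tt , s
    adj : ∀ p {q} → Graph.Adj E p q → Graph.Adj L (fun p) (fun q)
    adj (inj₁ _) {inj₂ _} s = tt , tt , s
    adj (inj₂ _) {inj₁ _} s = tt , tt , s
  toLetters : Hom L E
  toLetters = record { fun = fun ; vtx = λ {p} → vtx p ; adj = λ {p} → adj p }
    where
    fun : Word A ⊎ Word A → A ⊎ A
    fun (inj₁ x) = inj₁ (firstLetter x)
    fun (inj₂ y) = inj₂ (firstLetter y)
    vtx : ∀ p → Graph.Vtx L p → Graph.Vtx E (fun p)
    vtx (inj₁ (_ ∷ [])) (_ , s) = s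
    vtx (inj₂ (_ ∷ [])) (_ , s) = s
    adj : ∀ p {q} → Graph.Adj L p q → Graph.Adj E (fun p) (fun q)
    adj (inj₁ (_ ∷ [])) {inj₂ (_ ∷ [])} (_ , _ , s) = s
    adj (inj₂ (_ ∷ [])) {inj₁ (_ ∷ [])} (_ , _ , s) = s
  toWords∘toLetters : ∀ {p} → Graph.Vtx L p → Hom.fun toWords (Hom.fun toLetters p) ≡ p
  toWords∘toLetters {inj₁ (_ ∷ [])} _ = refl
  toWords∘toLetters {inj₂ (_ ∷ [])} _ = refl

-- Reversal

reverse-++³ : ∀ {A : Set} (x y z : Word A) → reverse (x ++ y ++ z) ≡ reverse z ++ reverse y ++ reverse x
reverse-++³ x y z = trans (reverse-++ x (y ++ z)) (trans (cong (_++ reverse x) (reverse-++ y z))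
                                                          (++-assoc (reverse z) (reverse y) (reverse x)))

module _ {A : Set} {S S′ : WordSet A}
         (S′⇒S : ∀ x → S′ x → S (reverse x)) (S⇒S′ : ∀ x → S x → S′ (reverse x)) where

  GenExtGraph-reverse-IsTree : ∀ {U V : WordSet A} {w} → IsTree (GenExtGraph S′ U V (reverse w)) →
    IsTree (GenExtGraph S (V ∘′ reverse) (U ∘′ reverse) w)
  GenExtGraph-reverse-IsTree {U} {V} {w} = IsTree-retract forth back mirror²
    where
    E′ = GenExtGraph S′ U V (reverse w)
    E = GenExtGraph S (V ∘′ reverse) (U ∘′ reverse) w
    mirror : Word A ⊎ Word A → Word A ⊎ Word A
    mirror (inj₁ x) = inj₂ (reverse x)
    mirror (inj₂ y) = inj₁ (reverse y)
    mirror² : ∀ {p} → Graph.Vtx E p → mirror (mirror p) ≡ p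
    mirror² {inj₁ x} _ = cong inj₁ (reverse-involutive x)
    mirror² {inj₂ y} _ = cong inj₂ (reverse-involutive y)
    rev² : ∀ (P : WordSet A) x → P x → P (reverse (reverse x))
    rev² P x = subst P (sym (reverse-involutive x))
    S-rev : ∀ x {y} → reverse x ≡ y → S′ x → S y
    S-rev x e s = subst S e (S′⇒S x s)
    forth : Hom E′ E
    forth = record { fun = mirror ; vtx = λ {p} → vtx p ; adj = λ {p} → adj p }
      where
      vtx : ∀ p → Graph.Vtx E′ p → Graph.Vtx E (mirror p)
      vtx (inj₁ x) (x∈U , s) = rev² U x x∈U ,
        S-rev (x ++ reverse w) (trans (reverse-++ x (reverse w)) (cong (_++ reverse x) (reverse-involutive w))) s
      vtx (inj₂ y) (y∈V , s) = rev² V y y∈V ,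
        S-rev (reverse w ++ y) (trans (reverse-++ (reverse w) y) (cong (reverse y ++_) (reverse-involutive w))) s
      adj : ∀ p {q} → Graph.Adj E′ p q → Graph.Adj E (mirror p) (mirror q)
      adj (inj₁ x) {inj₂ y} (x∈U , y∈V , s) = rev² V y y∈V , rev² U x x∈U ,
        S-rev (x ++ reverse w ++ y) (trans (reverse-++³ x (reverse w) y)
                                           (cong (λ v → reverse y ++ v ++ reverse x) (reverse-involutive w))) s
      adj (inj₂ y) {inj₁ x} (x∈U , y∈V , s) = rev² V y y∈V , rev² U x x∈U ,
        S-rev (x ++ reverse w ++ y) (trans (reverse-++³ x (reverse w) y)
                                           (cong (λ v → reverse y ++ v ++ reverse x) (reverse-involutive w))) s
    back : Hom E E′
    back = record { fun = mirror ; vtx = λ {p} → vtx p ; adj = λ {p} → adj p }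
      where
      vtx : ∀ p → Graph.Vtx E p → Graph.Vtx E′ (mirror p)
      vtx (inj₁ x) (x∈V , s) = x∈V , subst S′ (reverse-++ x w) (S⇒S′ (x ++ w) s)
      vtx (inj₂ y) (y∈U , s) = y∈U , subst S′ (reverse-++ w y) (S⇒S′ (w ++ y) s)
      adj : ∀ p {q} → Graph.Adj E p q → Graph.Adj E′ (mirror p) (mirror q)
      adj (inj₁ x) {inj₂ y} (x∈V , y∈U , s) =
        y∈U , x∈V , subst S′ (reverse-++³ x w y) (S⇒S′ (x ++ w ++ y) s)
      adj (inj₂ y) {inj₁ x} (x∈V , y∈U , s) =
        y∈U , x∈V , subst S′ (reverse-++³ x w y) (S⇒S′ (x ++ w ++ y) s)

module _ {A : Set} {V : List (Word A)} where

  ∈-map-reverse⁻ : ∀ {x} → x ∈ map reverse V → reverse x ∈ V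
  ∈-map-reverse⁻ x∈ with ∈-map⁻ reverse x∈
  ... | y , y∈ , refl = subst (_∈ V) (sym (reverse-involutive y)) y∈

  ∈-map-reverse⁺ : ∀ {x} → reverse x ∈ V → x ∈ map reverse V
  ∈-map-reverse⁺ {x} x∈ = subst (_∈ map reverse V) (reverse-involutive x) (∈-map⁺ reverse x∈)

  map-reverse≐ : ∀ {P : WordSet A} → (⟦ map reverse V ⟧ ∘′ reverse) ≐ ⟦ V ⟧ within P
  map-reverse≐ x _ =
    (λ x∈ → subst (_∈ V) (reverse-involutive x) (∈-map-reverse⁻ x∈)) , ∈-map⁺ reverse

module _ {A : Set} where

  SuffixCode-mono : ∀ {X Y : WordSet A} → X ⊆ Y → SuffixCode Y → SuffixCode X
  SuffixCode-mono X⊆Y (nonempty , suffix-free) =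
    (λ x Xx → nonempty x (X⊆Y x Xx)) , λ x y z Xx Xy → suffix-free x y z (X⊆Y x Xx) (X⊆Y y Xy)

  private
    reverse-nonempty : ∀ {x : Word A} → x ≢ [] → reverse x ≢ []
    reverse-nonempty {x} x≢[] e = x≢[] (trans (sym (reverse-involutive x)) (cong reverse e))

    reverse-nonempty⁻ : ∀ {x : Word A} → reverse x ≢ [] → x ≢ []
    reverse-nonempty⁻ rx≢[] refl = rx≢[] refl

  PrefixCode-reverse : ∀ {X : WordSet A} → PrefixCode X → SuffixCode (X ∘′ reverse)
  PrefixCode-reverse (nonempty , prefix-free) =
    (λ x Xx → reverse-nonempty⁻ (nonempty (reverse x) Xx)) ,
    λ x y z Xx Xy z≢[] e → prefix-free (reverse x) (reverse y) (reverse z) Xx Xy (reverse-nonempty z≢[])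
                             (trans (cong reverse e) (reverse-++ z x))

  SuffixCode-reverse : ∀ {Y : WordSet A} → SuffixCode Y → PrefixCode (Y ∘′ reverse)
  SuffixCode-reverse (nonempty , suffix-free) =
    (λ x Yx → reverse-nonempty⁻ (nonempty (reverse x) Yx)) ,
    λ x y z Yx Yy z≢[] e → suffix-free (reverse x) (reverse y) (reverse z) Yx Yy (reverse-nonempty z≢[])
                             (trans (cong reverse e) (reverse-++ x z))

Letter-reverse : ∀ {A : Set} (x : Word A) → Letter x → Letter (reverse x)
Letter-reverse (_ ∷ []) _ = tt

Letter-reverse⁻ : ∀ {A : Set} (x : Word A) → Letter (reverse x) → Letter x
Letter-reverse⁻ x l = subst Letter (reverse-involutive x) (Letter-reverse (reverse x) l)

module _ {A : Set} {S : WordSet A} where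

  Biextendable-reverse : Biextendable S → Biextendable (S ∘′ reverse)
  Biextendable-reverse (fac , extend) = fac′ , extend′
    where
    fac′ : Factorial (S ∘′ reverse)
    fac′ x y z s = fac (reverse z) (reverse y) (reverse x) (subst S (reverse-++³ x y z) s)
    extend′ : ∀ w → S (reverse w) → ∃[ a ] ∃[ b ] S (reverse (a ∷ w ++ [ b ]))
    extend′ w s with extend (reverse w) s
    ... | a , b , s′ = b , a , subst S (sym (reverse-++³ [ b ] w [ a ])) s′

  SMaximalPrefixCode-reverse : ∀ {V} → SMaximalPrefixCode S ⟦ V ⟧ →
                               SMaximalSuffixCode (S ∘′ reverse) ⟦ map reverse V ⟧
  SMaximalPrefixCode-reverse {V} (V⊆S , prefixCode , maximal) =
    (λ x x∈ → V⊆S (reverse x) (∈-map-reverse⁻ x∈)) ,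
    SuffixCode-mono (λ _ → ∈-map-reverse⁻) (PrefixCode-reverse prefixCode) ,
    λ Y suffixCode Y⊆S˘ (V˘⊆Y , y , Yy , y∉V˘) →
      maximal (Y ∘′ reverse) (SuffixCode-reverse suffixCode)
        (λ x Yx → subst S (reverse-involutive x) (Y⊆S˘ (reverse x) Yx))
        ((λ x x∈ → V˘⊆Y (reverse x) (∈-map⁺ reverse x∈)) ,
         reverse y , subst Y (sym (reverse-involutive y)) Yy , λ x∈ → y∉V˘ (∈-map-reverse⁺ x∈))

module WithDecidableLetters {A : Set} (_≟_ : DecidableEquality A) where

  _≟ʷ_ : DecidableEquality (Word A)
  _≟ʷ_ = ≡-dec _≟_

  leftExtension? : ∀ u x → Dec (LeftExtension u x)
  leftExtension? u [] = no λ ()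
  leftExtension? u (_ ∷ x) = x ≟ʷ u

  suffix? : ∀ u x → Dec (Suffix u x)
  suffix? [] [] = yes ([] , refl)
  suffix? (_ ∷ _) [] = no λ { ([] , ()) ; (_ ∷ _ , ()) }
  suffix? u (a ∷ x) with (a ∷ x) ≟ʷ u | suffix? u x
  ... | yes e | _ = yes ([] , e)
  ... | no _ | yes (z , e) = yes (a ∷ z , cong (a ∷_) e)
  ... | no ≢u | no ¬suf = no λ { ([] , e) → ≢u e ; (_ ∷ z , e) → ¬suf (z , ∷-injectiveʳ e) }

  properSuffix? : ∀ x u → Dec (ProperSuffix x u)
  properSuffix? x [] = no λ { (_ , _ , ()) }
  properSuffix? x (a ∷ u) with suffix? x u
  ... | yes (z , e) = yes (a , z , cong (a ∷_) e)
  ... | no ¬suf = no λ { (_ , z , e) → ¬suf (z , ∷-injectiveʳ e) }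

  longest : (U : List (Word A)) → U ≡ [] ⊎ ∃[ u ] u ∈ U × (∀ {x} → x ∈ U → length x ≤ length u)
  longest [] = inj₁ refl
  longest (x ∷ U) with longest U
  ... | inj₁ refl = inj₂ (x , here refl , λ { (here refl) → ≤-refl })
  ... | inj₂ (u , u∈ , max) with length x ≤? length u
  ...   | yes x≤u = inj₂ (u , there u∈ , λ { (here refl) → x≤u ; (there j) → max j })
  ...   | no x≰u =
    inj₂ (x , here refl , λ { (here refl) → ≤-refl ; (there j) → ≤-trans (max j) (≰⇒≥ x≰u) })

  -- Maximal suffix codes

  module MaximalSuffixCode (S : WordSet A) (fac : Factorial S)
                           (U : List (Word A)) (isMax : SMaximalSuffixCode S ⟦ U ⟧) where

    code⊆S : ⟦ U ⟧ ⊆ S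
    code⊆S = proj₁ isMax

    nonempty : ∀ x → x ∈ U → x ≢ []
    nonempty = proj₁ (proj₁ (proj₂ isMax))

    suffix-free : ∀ x y z → x ∈ U → y ∈ U → z ≢ [] → y ≡ z ++ x → ⊥
    suffix-free = proj₂ (proj₁ (proj₂ isMax))

    maximal : ∀ Y → SuffixCode Y → Y ⊆ S → ¬ (⟦ U ⟧ ⊆ Y × ∃[ y ] (Y y × ¬ ⟦ U ⟧ y))
    maximal = proj₂ (proj₂ isMax)

    -- Otherwise U ∪ {x} would be a larger suffix code in S.
    suffix-comparable : ∀ x → S x → x ≢ [] →
      (∃[ u ] u ∈ U × Suffix u x) ⊎ (∃[ u ] u ∈ U × ProperSuffix x u)
    suffix-comparable x sx x≢[] with any? (λ u → suffix? u x) U | any? (properSuffix? x) U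
    ... | yes has | _ = inj₁ (find has)
    ... | no _ | yes has = inj₂ (find has)
    ... | no ¬suf | no ¬pre =
      ⊥-elim (maximal Y (Y-nonempty , Y-suffix-free) Y⊆S
                ((λ _ → inj₁) , x , inj₂ refl , λ x∈ → ¬suf (lose x∈ ([] , refl))))
      where
      Y : WordSet A
      Y y = y ∈ U ⊎ y ≡ x
      Y-nonempty : ∀ y → Y y → y ≢ []
      Y-nonempty y (inj₁ y∈) = nonempty y y∈
      Y-nonempty y (inj₂ refl) = x≢[]
      Y⊆S : Y ⊆ S
      Y⊆S y (inj₁ y∈) = code⊆S y y∈
      Y⊆S y (inj₂ refl) = sx
      Y-suffix-free : ∀ y y′ z → Y y → Y y′ → z ≢ [] → y′ ≡ z ++ y → ⊥
      Y-suffix-free y y′ [] _ _ z≢[] _ = z≢[] refl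
      Y-suffix-free y y′ z (inj₁ y∈) (inj₁ y′∈) z≢[] e = suffix-free y y′ z y∈ y′∈ z≢[] e
      Y-suffix-free y y′ z (inj₁ y∈) (inj₂ refl) _ e = ¬suf (lose y∈ (z , e))
      Y-suffix-free y y′ (a ∷ z) (inj₂ refl) (inj₁ y′∈) _ e = ¬pre (lose y′∈ (a , z , e))
      Y-suffix-free y y′ (a ∷ z) (inj₂ refl) (inj₂ refl) _ e = ≢-++-self y (a ∷ z) (λ ()) e

    Letter≐short-code : (∀ {x} → x ∈ U → length x ≤ 1) → Letter ≐ ⟦ U ⟧ within S
    Letter≐short-code short x sx = Letter⇒∈U x sx , ∈U⇒Letter x
      where
      ∈U⇒Letter : ∀ x → x ∈ U → Letter x
      ∈U⇒Letter [] x∈ = nonempty [] x∈ refl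
      ∈U⇒Letter (_ ∷ []) _ = tt
      ∈U⇒Letter (_ ∷ _ ∷ _) x∈ with short x∈
      ... | s≤s ()
      Letter⇒∈U : ∀ x → S x → Letter x → x ∈ U
      Letter⇒∈U (a ∷ []) sx _ with suffix-comparable (a ∷ []) sx (λ ())
      ... | inj₁ (u , u∈ , [] , refl) = u∈
      ... | inj₁ (u , u∈ , _ ∷ [] , refl) = ⊥-elim (nonempty [] u∈ refl)
      ... | inj₂ (u , u∈ , b , z , refl) =
        ⊥-elim (1+n≰n (≤-trans (s≤s (length-++-≤ʳ (a ∷ []) {z})) (short u∈)))

    module Shorten (a : A) (u : Word A) (au∈ : a ∷ u ∈ U)
                   (au-longest : ∀ {x} → x ∈ U → length x ≤ length (a ∷ u)) (u≢[] : u ≢ []) where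

      notAu? : ∀ x → Dec (¬ LeftExtension u x)
      notAu? x = ¬? (leftExtension? u x)

      U′ : List (Word A)
      U′ = u ∷ filter notAu? U

      private
        ∈-filtered⁻ : ∀ {x} → x ∈ filter notAu? U → x ∈ U × ¬ LeftExtension u x
        ∈-filtered⁻ = ∈-filter⁻ notAu? {xs = U}

      u∉U : ¬ u ∈ U
      u∉U u∈ = suffix-free u (a ∷ u) (a ∷ []) u∈ au∈ (λ ()) refl

      U⊆U′ : ∀ x → x ∈ U → ¬ LeftExtension u x → x ∈ U′
      U⊆U′ x x∈ x∉Au = there (∈-filter⁺ notAu? x∈ x∉Au)

      U′⊆U : ∀ x → x ∈ U′ → x ≢ u → x ∈ U
      U′⊆U x (here refl) x≢u = ⊥-elim (x≢u refl)
      U′⊆U x (there x∈) _ = proj₁ (∈-filtered⁻ x∈)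

      U′-disjoint-Au : ∀ x → x ∈ U′ → ¬ LeftExtension u x
      U′-disjoint-Au (_ ∷ _) (here refl) ()
      U′-disjoint-Au x (there x∈) = proj₂ (∈-filtered⁻ x∈)

      -- A word b u of S has no proper suffix in U (a u would be one, by suffix-freeness
      -- and length), and is no proper suffix of one (a u is longest).
      Au∩S⊆U : ∀ b → S (b ∷ u) → b ∷ u ∈ U
      Au∩S⊆U b s with suffix-comparable (b ∷ u) s (λ ())
      ... | inj₁ (v , v∈ , [] , refl) = v∈
      ... | inj₁ (v , v∈ , c ∷ z , e) =
        ⊥-elim (suffix-free v (a ∷ u) (a ∷ z) v∈ au∈ (λ ()) (cong (a ∷_) (∷-injectiveʳ e)))
      ... | inj₂ (v , v∈ , c , z , refl) with au-longest v∈
      ...   | s≤s le = ⊥-elim (1+n≰n (≤-trans (length-++-≤ʳ (b ∷ u) {z}) le))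

      U′⊆S : ⟦ U′ ⟧ ⊆ S
      U′⊆S x (here refl) = factorˡ fac (a ∷ []) u (code⊆S (a ∷ u) au∈)
      U′⊆S x (there x∈) = code⊆S x (proj₁ (∈-filtered⁻ x∈))

      U′-nonempty : ∀ x → x ∈ U′ → x ≢ []
      U′-nonempty x (here refl) = u≢[]
      U′-nonempty x (there x∈) = nonempty x (proj₁ (∈-filtered⁻ x∈))

      U′-suffix-free : ∀ x y z → x ∈ U′ → y ∈ U′ → z ≢ [] → y ≡ z ++ x → ⊥
      U′-suffix-free x y [] _ _ z≢[] _ = z≢[] refl
      U′-suffix-free x y z (here refl) (here refl) z≢[] e = ≢-++-self x z z≢[] e
      U′-suffix-free x y (c ∷ []) (here refl) (there y∈) _ refl = proj₂ (∈-filtered⁻ y∈) refl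
      U′-suffix-free x y (c ∷ d ∷ z) (here refl) (there y∈) _ refl =
        1+n≰n (≤-trans (s≤s (s≤s (length-++-≤ʳ x {z}))) (au-longest (proj₁ (∈-filtered⁻ y∈))))
      U′-suffix-free x y (c ∷ z) (there x∈) (here refl) _ e =
        suffix-free x (a ∷ u) (a ∷ c ∷ z) (proj₁ (∈-filtered⁻ x∈)) au∈ (λ ()) (cong (a ∷_) e)
      U′-suffix-free x y z (there x∈) (there y∈) z≢[] e =
        suffix-free x y z (proj₁ (∈-filtered⁻ x∈)) (proj₁ (∈-filtered⁻ y∈)) z≢[] e

      -- A suffix code Y ⊋ U′ in S yields the suffix code (Y ∖ {u}) ∪ (A u ∩ S) ⊋ U.
      U′-maximal : ∀ Y → SuffixCode Y → Y ⊆ S →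
                   ¬ (⟦ U′ ⟧ ⊆ Y × ∃[ y ] (Y y × ¬ ⟦ U′ ⟧ y))
      U′-maximal Y (Y-nonempty , Y-suffix-free) Y⊆S (U′⊆Y , y , Yy , y∉U′) =
        maximal Z (Z-nonempty , Z-suffix-free) Z⊆S (U⊆Z , y , inj₁ (Yy , y≢u) , y∉U)
        where
        Z : WordSet A
        Z x = (Y x × x ≢ u) ⊎ (∃[ b ] x ≡ b ∷ u × S x)
        Yu : Y u
        Yu = U′⊆Y u (here refl)
        y≢u : y ≢ u
        y≢u refl = y∉U′ (here refl)
        U⊆Z : ⟦ U ⟧ ⊆ Z
        U⊆Z [] x∈ = ⊥-elim (nonempty [] x∈ refl)
        U⊆Z (b ∷ x) x∈ with x ≟ʷ u
        ... | yes refl = inj₂ (b , refl , code⊆S (b ∷ x) x∈)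
        ... | no x≢u = inj₁ (U′⊆Y (b ∷ x) (U⊆U′ (b ∷ x) x∈ x≢u) , λ { refl → u∉U x∈ })
        y∉U : ¬ y ∈ U
        y∉U y∈ with leftExtension? u y
        ... | no y∉Au = y∉U′ (U⊆U′ y y∈ y∉Au)
        ... | yes y∈Au with leftExtension⇒≡ y y∈Au
        ...   | b , y≡bu = Y-suffix-free u y [ b ] Yu Yy (λ ()) y≡bu
        Z⊆S : Z ⊆ S
        Z⊆S x (inj₁ (Yx , _)) = Y⊆S x Yx
        Z⊆S x (inj₂ (_ , _ , sx)) = sx
        Z-nonempty : ∀ x → Z x → x ≢ []
        Z-nonempty x (inj₁ (Yx , _)) = Y-nonempty x Yx
        Z-nonempty x (inj₂ (_ , refl , _)) ()
        Z-suffix-free : ∀ x y z → Z x → Z y → z ≢ [] → y ≡ z ++ x → ⊥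
        Z-suffix-free x y [] _ _ z≢[] _ = z≢[] refl
        Z-suffix-free x y z (inj₁ (Yx , _)) (inj₁ (Yy , _)) z≢[] e = Y-suffix-free x y z Yx Yy z≢[] e
        Z-suffix-free x y (c ∷ []) (inj₁ (_ , x≢u)) (inj₂ (_ , refl , _)) _ e = x≢u (sym (∷-injectiveʳ e))
        Z-suffix-free x y (c ∷ d ∷ z) (inj₁ (Yx , _)) (inj₂ (_ , refl , _)) _ e =
          Y-suffix-free x u (d ∷ z) Yx Yu (λ ()) (∷-injectiveʳ e)
        Z-suffix-free x y (c ∷ z) (inj₂ (b , refl , _)) (inj₁ (Yy , _)) _ e =
          Y-suffix-free u y (c ∷ z ++ [ b ]) Yu Yy (λ ()) (trans e (sym (++-assoc (c ∷ z) [ b ] u)))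
        Z-suffix-free x y (c ∷ z) (inj₂ (b , refl , _)) (inj₂ (_ , refl , _)) _ e =
          ≢-++-self u (z ++ [ b ]) (λ z++b≡[] → case ++-conicalʳ z [ b ] z++b≡[] of λ ())
            (trans (∷-injectiveʳ e) (sym (++-assoc z [ b ] u)))

      U′-isMax : SMaximalSuffixCode S ⟦ U′ ⟧
      U′-isMax = U′⊆S , (U′-nonempty , U′-suffix-free) , U′-maximal

      private
        totalLength-filter : ∀ xs → totalLength (filter notAu? xs) ≤ totalLength xs
        totalLength-filter [] = z≤n
        totalLength-filter (x ∷ xs) with leftExtension? u x
        ... | no _ = +-monoʳ-≤ (length x) (totalLength-filter xs)
        ... | yes _ = ≤-trans (totalLength-filter xs) (m≤n+m (totalLength xs) (length x))

        totalLength-filter-au : ∀ xs → a ∷ u ∈ xs →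
          length (a ∷ u) + totalLength (filter notAu? xs) ≤ totalLength xs
        totalLength-filter-au (x ∷ xs) (here refl) with leftExtension? u x
        ... | no au∉Au = ⊥-elim (au∉Au refl)
        ... | yes _ = +-monoʳ-≤ (length x) (totalLength-filter xs)
        totalLength-filter-au (x ∷ xs) (there au∈xs) with leftExtension? u x
        ... | no _ = ≤-trans (≤-reflexive (x∙yz≈y∙xz (length (a ∷ u)) (length x) _))
                             (+-monoʳ-≤ (length x) (totalLength-filter-au xs au∈xs))
        ... | yes _ = ≤-trans (totalLength-filter-au xs au∈xs) (m≤n+m (totalLength xs) (length x))

      totalLength-decreases : suc (totalLength U′) ≤ totalLength U
      totalLength-decreases = totalLength-filter-au U au∈

  -- Gluing

  -- The hypotheses on U, U′ say that U = (U′ ∖ {u}) ∪ (A u ∩ S) and U′ ∩ A u = ∅.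
  module Gluing (S : WordSet A) (bi : Biextendable S) (U U′ V : WordSet A) (w u : Word A)
    (U⊆U′ : ∀ x → U x → ¬ LeftExtension u x → U′ x)
    (U′⊆U : ∀ x → U′ x → x ≢ u → U x)
    (u∉U : ¬ U u)
    (Au∩S⊆U : ∀ b → S (b ∷ u) → U (b ∷ u))
    (U′-disjoint-Au : ∀ x → U′ x → ¬ LeftExtension u x)
    (u∈U′ : U′ u)
    (tree-T : S (u ++ w) → IsTree (GenExtGraph S Letter V (u ++ w)))
    (tree-H : IsTree (GenExtGraph S U′ V w))
    where

    private
      fac = proj₁ bi
      extend = proj₂ bi

      Vertex = Word A ⊎ Word A
      G = GenExtGraph S U V w
      H = GenExtGraph S U′ V w
      T = GenExtGraph S Letter V (u ++ w)
      open Graph G renaming (Vtx to VG; Adj to AG)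
      open Graph H renaming (Vtx to VH; Adj to AH)
      open Graph T renaming (Vtx to VT; Adj to AT)

      reassoc : ∀ x y z → S ((x ++ y) ++ z) → S (x ++ y ++ z)
      reassoc x y z = subst S (++-assoc x y z)

      reassoc⁻ : ∀ x y z → S (x ++ y ++ z) → S ((x ++ y) ++ z)
      reassoc⁻ x y z = subst S (sym (++-assoc x y z))

    InAu : Vertex → Set
    InAu (inj₁ x) = LeftExtension u x
    InAu (inj₂ _) = ⊥

    inAu? : ∀ p → Dec (InAu p)
    inAu? (inj₁ x) = leftExtension? u x
    inAu? (inj₂ _) = no λ ()

    OutsideAu : Vertex → Set
    OutsideAu (inj₁ x) = ¬ LeftExtension u x
    OutsideAu (inj₂ _) = ⊥

    outsideAu? : ∀ p → Dec (OutsideAu p)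
    outsideAu? (inj₁ x) = ¬? (leftExtension? u x)
    outsideAu? (inj₂ _) = no λ ()

    u∉G : ∀ {p} → VG p → p ≢ inj₁ u
    u∉G (u∈U , _) refl = u∉U u∈U

    embed : Hom T G
    embed = record { fun = fun ; vtx = vtx ; adj = adj }
      where
      fun : Vertex → Vertex
      fun (inj₁ b) = inj₁ (b ++ u)
      fun (inj₂ r) = inj₂ r
      vtx : ∀ {p} → VT p → VG (fun p)
      vtx {inj₁ (b ∷ [])} (_ , s) = Au∩S⊆U b (factorʳ fac (b ∷ u) w s) , s
      vtx {inj₂ r} (r∈V , s) = r∈V , factorˡ fac u (w ++ r) (reassoc u w r s)
      adj : ∀ {p q} → AT p q → AG (fun p) (fun q)
      adj {inj₁ (b ∷ [])} {inj₂ r} (_ , r∈V , s) =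
        Au∩S⊆U b (factorʳ fac (b ∷ u) (w ++ r) (reassoc (b ∷ u) w r s)) , r∈V , reassoc (b ∷ u) w r s
      adj {inj₂ r} {inj₁ (b ∷ [])} (_ , r∈V , s) =
        Au∩S⊆U b (factorʳ fac (b ∷ u) (w ++ r) (reassoc (b ∷ u) w r s)) , r∈V , reassoc (b ∷ u) w r s

    collapse : Hom G H
    collapse = record { fun = fun ; vtx = λ {p} → vtx p ; adj = λ {p} → adj p }
      where
      fun : Vertex → Vertex
      fun (inj₁ []) = inj₁ []
      fun (inj₁ (b ∷ x)) with x ≟ʷ u
      ... | yes _ = inj₁ u
      ... | no _ = inj₁ (b ∷ x)
      fun (inj₂ r) = inj₂ r
      vtx : ∀ p → VG p → VH (fun p)
      vtx (inj₁ []) (x∈U , s) = U⊆U′ [] x∈U (λ ()) , s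
      vtx (inj₁ (b ∷ x)) (x∈U , s) with x ≟ʷ u
      ... | yes refl = u∈U′ , factorˡ fac (b ∷ []) (u ++ w) s
      ... | no x≢u = U⊆U′ (b ∷ x) x∈U x≢u , s
      vtx (inj₂ r) v = v
      adj : ∀ p {q} → AG p q → AH (fun p) (fun q)
      adj (inj₁ []) {inj₂ r} (x∈U , r∈V , s) = U⊆U′ [] x∈U (λ ()) , r∈V , s
      adj (inj₁ (b ∷ x)) {inj₂ r} (x∈U , r∈V , s) with x ≟ʷ u
      ... | yes refl = u∈U′ , r∈V , factorˡ fac (b ∷ []) (u ++ w ++ r) s
      ... | no x≢u = U⊆U′ (b ∷ x) x∈U x≢u , r∈V , s
      adj (inj₂ r) {inj₁ []} (x∈U , r∈V , s) = U⊆U′ [] x∈U (λ ()) , r∈V , s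
      adj (inj₂ r) {inj₁ (b ∷ x)} (x∈U , r∈V , s) with x ≟ʷ u
      ... | yes refl = u∈U′ , r∈V , factorˡ fac (b ∷ []) (u ++ w ++ r) s
      ... | no x≢u = U⊆U′ (b ∷ x) x∈U x≢u , r∈V , s

    private
      π = Hom.fun collapse

    π-Au : ∀ b → π (inj₁ (b ∷ u)) ≡ inj₁ u
    π-Au b with u ≟ʷ u
    ... | yes _ = refl
    ... | no u≢u = ⊥-elim (u≢u refl)

    π-outsideAu : ∀ p → ¬ InAu p → π p ≡ p
    π-outsideAu (inj₁ []) _ = refl
    π-outsideAu (inj₁ (b ∷ x)) p∉Au with x ≟ʷ u
    ... | yes x≡u = ⊥-elim (p∉Au x≡u)
    ... | no _ = refl
    π-outsideAu (inj₂ r) _ = refl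

    map-π-outsideAu : ∀ ps → All (¬_ ∘′ InAu) ps → map π ps ≡ ps
    map-π-outsideAu [] [] = refl
    map-π-outsideAu (p ∷ ps) (p∉Au ∷ ps∉Au) =
      cong₂ _∷_ (π-outsideAu p p∉Au) (map-π-outsideAu ps ps∉Au)

    VH-outsideAu : ∀ {p} → VG p → ¬ InAu p → VH p
    VH-outsideAu {p} v p∉Au = subst VH (π-outsideAu p p∉Au) (Hom.vtx collapse v)

    linked-collapse : ∀ {ps} → Linked AG ps → Linked AH (map π ps)
    linked-collapse l = Linked.map⁺ (Linked.map (λ {p} → Hom.adj collapse {p}) l)

    data LiesOver : Vertex → Vertex → Set where
      over-u    : ∀ b → LiesOver (inj₁ (b ∷ u)) (inj₁ u)
      over-self : ∀ p → ¬ InAu p → LiesOver p p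

    liesOver-π : ∀ p → LiesOver p (π p)
    liesOver-π (inj₁ []) = over-self _ λ ()
    liesOver-π (inj₁ (b ∷ x)) with x ≟ʷ u
    ... | yes refl = over-u b
    ... | no x≢u = over-self _ x≢u
    liesOver-π (inj₂ r) = over-self _ λ ()

    T-walk-from : ∀ {b p} → S (b ∷ u ++ w) → VT p → Walk T (inj₁ [ b ]) p
    T-walk-from {b} sb vp = proj₁ (proj₂ (tree-T (factorˡ fac [ b ] (u ++ w) sb))) _ _ (tt , sb) vp

    liftStep : ∀ {z y p} → AH z y → LiesOver p z → VG p →
               ∃[ p′ ] LiesOver p′ y × VG p′ × Walk G p p′
    liftStep {inj₁ _} {inj₂ r} (_ , r∈V , s) (over-u b) (_ , sb) =
      inj₂ r , over-self _ (λ ()) , (r∈V , factorˡ fac u (w ++ r) s) ,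
      mapWalk embed (T-walk-from sb (r∈V , reassoc⁻ u w r s))
    liftStep {inj₁ x} {inj₂ r} (_ , r∈V , s) (over-self _ _) vp@(x∈U , _) =
      inj₂ r , over-self _ (λ ()) , vr , step vp (x∈U , r∈V , s) (here vr)
      where
      vr : VG (inj₂ r)
      vr = r∈V , factorˡ fac x (w ++ r) s
    liftStep {inj₂ r} {inj₁ x} (x∈U′ , r∈V , s) (over-self _ _) vp with x ≟ʷ u
    ... | no x≢u = inj₁ x , over-self _ (U′-disjoint-Au x x∈U′) , vx , step vp (x∈U , r∈V , s) (here vx)
      where
      x∈U = U′⊆U x x∈U′ x≢u
      vx : VG (inj₁ x)
      vx = x∈U , factorʳ fac (x ++ w) r (reassoc⁻ x w r s)
    ... | yes refl with extend (u ++ w ++ r) s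
    ...   | c , d , scd = inj₁ (c ∷ u) , over-u c , vcu , step vp (cu∈U , r∈V , scuwr) (here vcu)
      where
      scuwr : S (c ∷ u ++ w ++ r)
      scuwr = factorʳ fac (c ∷ u ++ w ++ r) [ d ] scd
      cu∈U = Au∩S⊆U c (factorʳ fac (c ∷ u) (w ++ r) scuwr)
      vcu : VG (inj₁ (c ∷ u))
      vcu = cu∈U , factorʳ fac ((c ∷ u) ++ w) r (reassoc⁻ (c ∷ u) w r scuwr)

    liftWalk : ∀ {z z′} → Walk H z z′ →
               ∀ {p q} → LiesOver p z → LiesOver q z′ → VG p → VG q → Walk G p q
    liftWalk (here _) (over-u _) (over-u _) (_ , sb) (_ , sb′) = mapWalk embed (T-walk-from sb (tt , sb′))
    liftWalk (here _) (over-u _) (over-self _ _) _ vq = ⊥-elim (u∉G vq refl)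
    liftWalk (here _) (over-self _ _) (over-u _) vp _ = ⊥-elim (u∉G vp refl)
    liftWalk (here _) (over-self p _) (over-self .p _) vp _ = here vp
    liftWalk (step _ zy walk) p/z q/z′ vp vq with liftStep zy p/z vp
    ... | p′ , p′/y , vp′ , walk′ = walk′ ++ʷ liftWalk walk p′/y q/z′ vp′ vq

    G-nonempty : ∃[ p ] VG p
    G-nonempty with proj₁ tree-H
    ... | inj₂ r , v = inj₂ r , v
    ... | inj₁ x , (x∈U′ , s) with x ≟ʷ u
    ...   | no x≢u = inj₁ x , U′⊆U x x∈U′ x≢u , s
    ...   | yes refl with extend (u ++ w) s
    ...     | c , d , scd =
      inj₁ (c ∷ u) , Au∩S⊆U c (factorʳ fac (c ∷ u) (w ++ [ d ]) (reassoc (c ∷ u) w [ d ] scd)) ,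
      factorʳ fac (c ∷ u ++ w) [ d ] scd

    G-connected : Connected G
    G-connected p q vp vq =
      liftWalk (proj₁ (proj₂ tree-H) (π p) (π q) (Hom.vtx collapse vp) (Hom.vtx collapse vq))
               (liesOver-π p) (liesOver-π q) vp vq

    private
      acyclic-H : ClosedCycle H → ⊥
      acyclic-H C = proj₂ (proj₂ tree-H) (fromClosedCycle H C)

    -- Collapsing to u the stretch of a cycle between its first and its last vertex in A u.
    contract : ∀ x a as b bs ms b′ es → ¬ LeftExtension u x →
      All (¬_ ∘′ InAu) (a ∷ as) → All (¬_ ∘′ InAu) es →
      inj₁ (b ∷ u) ∷ bs ≡ ms ++ inj₁ (b′ ∷ u) ∷ es →
      All VG (inj₁ x ∷ (a ∷ as) ++ inj₁ (b ∷ u) ∷ bs) →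
      Unique (inj₁ x ∷ (a ∷ as) ++ inj₁ (b ∷ u) ∷ bs) →
      Linked AG (inj₁ x ∷ ((a ∷ as) ++ inj₁ (b ∷ u) ∷ bs) ++ [ inj₁ x ]) →
      ClosedCycle H
    contract x a as b bs ms b′ es x∉Au pre∉Au es∉Au split inG dist linked = record
      { start = inj₁ x ; rest = (a ∷ as) ++ inj₁ u ∷ es
      ; long = s≤s (≤-trans (s≤s z≤n) (≤-reflexive (sym (length-++-sucʳ as (inj₁ u) es))))
      ; inG = All.++⁺ (All.zipWith (λ (v , p∉Au) → VH-outsideAu v p∉Au) (inG-pre , x∉Au ∷ pre∉Au))
                      (vu ∷ All.zipWith (λ (v , p∉Au) → VH-outsideAu v p∉Au) (inG-es , es∉Au))
      ; dist = dist′
      ; linked = subst (Linked AH) (cong (inj₁ x ∷_) (sym (++-assoc (a ∷ as) (inj₁ u ∷ es) [ inj₁ x ])))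
                   (linked-join pre (inj₁ u) linked-pre linked-es) }
      where
      pre = inj₁ x ∷ a ∷ as
      d = inj₁ (b ∷ u)
      d′ = inj₁ (b′ ∷ u)
      inG-pre : All VG pre
      inG-pre = All.++⁻ˡ pre inG
      inG-es : All VG es
      inG-es = All.tail (All.++⁻ʳ ms (subst (All VG) split (All.++⁻ʳ pre inG)))
      vu : VH (inj₁ u)
      vu = subst VH (π-Au b) (Hom.vtx collapse (All.head (All.++⁻ʳ pre inG)))
      dist′ : Unique (pre ++ inj₁ u ∷ es)
      dist′ with unique-++⁻ pre (unique-dropMiddle pre (ms ++ [ d′ ])
                   (subst (λ l → Unique (pre ++ l)) (trans split (sym (++-assoc ms [ d′ ] es))) dist))
      ... | dist-pre , dist-es , disjoint =
        Unique.++⁺ dist-pre (All.map (λ v e → u∉G v (sym e)) inG-es ∷ dist-es)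
          λ { (i , here refl) → u∉G (All.lookup inG-pre i) refl ; (i , there j) → disjoint (i , j) }
      linked-split-d : Linked AG (pre ++ [ d ]) × Linked AG (d ∷ bs ++ [ inj₁ x ])
      linked-split-d = linked-split pre d
        (subst (Linked AG) (cong (inj₁ x ∷_) (++-assoc (a ∷ as) (d ∷ bs) [ inj₁ x ])) linked)
      linked-pre : Linked AH (pre ++ [ inj₁ u ])
      linked-pre = subst (Linked AH)
        (trans (map-++ π pre [ d ]) (cong₂ _++_ (map-π-outsideAu pre (x∉Au ∷ pre∉Au)) (cong [_] (π-Au b))))
        (linked-collapse (proj₁ linked-split-d))
      linked-es : Linked AH (inj₁ u ∷ es ++ [ inj₁ x ])
      linked-es = subst (Linked AH)
        (cong₂ _∷_ (π-Au b′) (map-π-outsideAu (es ++ [ inj₁ x ]) (All.++⁺ es∉Au (x∉Au ∷ []))))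
        (linked-collapse (linked-dropˡ ms
          (subst (Linked AG) (trans (cong (_++ [ inj₁ x ]) split) (++-assoc ms (d′ ∷ es) [ inj₁ x ]))
            (proj₂ linked-split-d))))

    acyclic-outsideAu : (C : ClosedCycle G) → OutsideAu (ClosedCycle.start C) → ⊥
    acyclic-outsideAu
      record { start = inj₁ x ; rest = rest ; long = long ; inG = inG ; dist = dist ; linked = linked } x∉Au
      with any? inAu? rest
    ... | no none = acyclic-H record
      { start = inj₁ x ; rest = rest ; long = long ; dist = dist
      ; inG = All.zipWith (λ (v , p∉Au) → VH-outsideAu v p∉Au) (inG , all∉Au)
      ; linked = subst (Linked AH) (map-π-outsideAu _ (All.++⁺ all∉Au (x∉Au ∷ []))) (linked-collapse linked) }
      where
      all∉Au : All (¬_ ∘′ InAu) (inj₁ x ∷ rest)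
      all∉Au = x∉Au ∷ All.¬Any⇒All¬ rest none
    ... | yes some with split-first inAu? rest some
    ...   | [] , inj₁ (b ∷ _) , _ , refl , _ , refl with linked
    ...     | () ∷ _
    acyclic-outsideAu record { start = inj₁ x ; inG = inG ; dist = dist ; linked = linked } x∉Au
        | yes _ | a ∷ as , inj₁ (b ∷ _) , bs , refl , pre∉Au , refl
      with split-last inAu? (inj₁ (b ∷ u) ∷ bs) (here refl)
    ... | ms , inj₁ (b′ ∷ _) , es , split , refl , es∉Au =
      acyclic-H (contract x a as b bs ms b′ es x∉Au pre∉Au es∉Au split inG dist linked)

    AuOrRight : Vertex → Set
    AuOrRight (inj₁ x) = LeftExtension u x
    AuOrRight (inj₂ _) = ⊤

    auOrRight : ∀ p → ¬ OutsideAu p → AuOrRight p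
    auOrRight (inj₁ x) ¬out = decidable-stable (leftExtension? u x) ¬out
    auOrRight (inj₂ _) _ = tt

    uncollapse : Vertex → Vertex
    uncollapse (inj₁ []) = inj₁ []
    uncollapse (inj₁ (b ∷ _)) = inj₁ [ b ]
    uncollapse (inj₂ r) = inj₂ r

    uncollapse-adj : ∀ {p q} → AuOrRight p → AuOrRight q → AG p q → AT (uncollapse p) (uncollapse q)
    uncollapse-adj {inj₁ (b ∷ _)} {inj₂ r} refl _ (_ , r∈V , s) =
      tt , r∈V , subst S (cong (b ∷_) (sym (++-assoc u w r))) s
    uncollapse-adj {inj₂ r} {inj₁ (b ∷ _)} _ refl (_ , r∈V , s) =
      tt , r∈V , subst S (cong (b ∷_) (sym (++-assoc u w r))) s

    uncollapse-injective : ∀ {p q} → AuOrRight p → AuOrRight q → uncollapse p ≡ uncollapse q → p ≡ q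
    uncollapse-injective {inj₁ (_ ∷ _)} {inj₁ (_ ∷ _)} refl refl refl = refl
    uncollapse-injective {inj₂ _} {inj₂ _} _ _ refl = refl
    uncollapse-injective {inj₂ _} {inj₁ (_ ∷ _)} _ _ ()

    -- A cycle all of whose left vertices lie in A u comes from a cycle of E_{A,V}(u w).
    acyclic-inAu : (C : ClosedCycle G) →
                   All (¬_ ∘′ OutsideAu) (ClosedCycle.start C ∷ ClosedCycle.rest C) → ⊥
    acyclic-inAu C ¬out =
      proj₂ (proj₂ (tree-T (GenExtGraph-vtx⇒S fac (All.head inG′)))) (fromClosedCycle T record
        { start = uncollapse start ; rest = map uncollapse rest
        ; long = ≤-trans long (≤-reflexive (sym (length-map uncollapse rest)))
        ; inG = inG′
        ; dist = unique-map⁺ uncollapse uncollapse-injective onImage dist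
        ; linked = linked′ })
      where
      open ClosedCycle C
      onImage : All AuOrRight (start ∷ rest)
      onImage = All.map (auOrRight _) ¬out
      linked′ : Linked AT (uncollapse start ∷ map uncollapse rest ++ [ uncollapse start ])
      linked′ = subst (Linked AT) (cong (uncollapse start ∷_) (map-++ uncollapse rest [ start ]))
        (Linked.map⁺ (linked-mono uncollapse-adj (All.++⁺ onImage (All.head onImage ∷ [])) linked))
      inG′ : All VT (uncollapse start ∷ map uncollapse rest)
      inG′ = linked-vertices (GenExtGraph-adj⇒vtx fac) (uncollapse start ∷ map uncollapse rest) linked′

    G-acyclic : Acyclic G
    G-acyclic c with toClosedCycle G c
    ... | C with any? outsideAu? (ClosedCycle.start C ∷ ClosedCycle.rest C)
    ...   | no none = acyclic-inAu C (All.¬Any⇒All¬ _ none)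
    ...   | yes some with find some
    ...     | _ , p∈C , p∉Au with rotate G C p∈C
    ...       | C′ , refl = acyclic-outsideAu C′ p∉Au

    G-tree : IsTree G
    G-tree = G-nonempty , G-connected , G-acyclic

  module _ (S : WordSet A) (bi : Biextendable S) (V : WordSet A)
           (tree-Letter : ∀ w → S w → IsTree (GenExtGraph S Letter V w)) where

    private
      fac = proj₁ bi

    IsTree-shortSuffixCode : ∀ U → SMaximalSuffixCode S ⟦ U ⟧ → (∀ {x} → x ∈ U → length x ≤ 1) →
                             ∀ w → S w → IsTree (GenExtGraph S ⟦ U ⟧ V w)
    IsTree-shortSuffixCode U isMax short w sw =
      GenExtGraph-IsTree-resp fac (MaximalSuffixCode.Letter≐short-code S fac U isMax short) (λ _ _ → id , id)
        (tree-Letter w sw)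

    IsTree-maximalSuffixCode : ∀ U → SMaximalSuffixCode S ⟦ U ⟧ →
                               ∀ w → S w → IsTree (GenExtGraph S ⟦ U ⟧ V w)
    IsTree-maximalSuffixCode U = bounded (totalLength U) U ≤-refl
      where
      bounded : ∀ n U → totalLength U ≤ n → SMaximalSuffixCode S ⟦ U ⟧ →
                ∀ w → S w → IsTree (GenExtGraph S ⟦ U ⟧ V w)
      bounded n U ≤n isMax w sw with longest U
      ... | inj₁ refl = IsTree-shortSuffixCode [] isMax (λ ()) w sw
      ... | inj₂ ([] , []∈U , _) = ⊥-elim (MaximalSuffixCode.nonempty S fac U isMax [] []∈U refl)
      ... | inj₂ (_ ∷ [] , _ , short) = IsTree-shortSuffixCode U isMax short w sw
      ... | inj₂ (a ∷ u@(_ ∷ _) , au∈U , au-longest) = glue n ≤n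
        where
        open MaximalSuffixCode S fac U isMax
        open Shorten a u au∈U au-longest (λ ())
        glue : ∀ n → totalLength U ≤ n → IsTree (GenExtGraph S ⟦ U ⟧ V w)
        glue zero ≤0 with ≤-trans totalLength-decreases ≤0
        ... | ()
        glue (suc n) ≤1+n =
          Gluing.G-tree S bi ⟦ U ⟧ ⟦ U′ ⟧ V w u
            U⊆U′ U′⊆U u∉U Au∩S⊆U U′-disjoint-Au (here refl)
            (tree-Letter (u ++ w))
            (bounded n U′ (≤-pred (≤-trans totalLength-decreases ≤1+n)) U′-isMax w sw)

  module _ (a₀ : A) (S : WordSet A) (isTreeSet : TreeSet S) where

    private
      bi = proj₁ isTreeSet
      S˘ = S ∘′ reverse
      S⇒S˘ : ∀ x → S x → S˘ (reverse x)
      S⇒S˘ x = subst S (sym (reverse-involutive x))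
      Letter≐Letter˘ : ∀ {P : WordSet A} → (Letter ∘′ reverse) ≐ Letter within P
      Letter≐Letter˘ x _ = Letter-reverse⁻ x , Letter-reverse x

    IsTree-Letter-Letter-reverse : ∀ w → S˘ w → IsTree (GenExtGraph S˘ Letter Letter w)
    IsTree-Letter-Letter-reverse w sw =
      GenExtGraph-IsTree-resp (proj₁ (Biextendable-reverse bi)) Letter≐Letter˘ Letter≐Letter˘
        (GenExtGraph-reverse-IsTree {S = S˘} {S′ = S} S⇒S˘ (λ _ s → s)
          (GenExtGraph-Letter-IsTree a₀ (proj₂ isTreeSet (reverse w) sw)))

    IsTree-Letter-maximalPrefixCode : ∀ V → SMaximalPrefixCode S ⟦ V ⟧ → ∀ w → S w →
      IsTree (GenExtGraph S Letter ⟦ V ⟧ w)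
    IsTree-Letter-maximalPrefixCode V isMax w sw =
      GenExtGraph-IsTree-resp (proj₁ bi) Letter≐Letter˘ map-reverse≐
        (GenExtGraph-reverse-IsTree {S = S} {S′ = S˘} (λ _ s → s) S⇒S˘
          (IsTree-maximalSuffixCode S˘ (Biextendable-reverse bi) Letter IsTree-Letter-Letter-reverse
             (map reverse V) (SMaximalPrefixCode-reverse isMax) (reverse w) (S⇒S˘ w sw)))

proposition3p9 : (k : ℕ) (S : WordSet (Fin (suc k))) → TreeSet S →
    (w : Word (Fin (suc k))) → S w →
    (U V : List (Word (Fin (suc k)))) →
    SMaximalSuffixCode S ⟦ U ⟧ → SMaximalPrefixCode S ⟦ V ⟧ →
    IsTree (GenExtGraph S ⟦ U ⟧ ⟦ V ⟧ w)
proposition3p9 k S isTreeSet w sw U V U-isMax V-isMax =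
  IsTree-maximalSuffixCode S (proj₁ isTreeSet) ⟦ V ⟧
    (IsTree-Letter-maximalPrefixCode Fin.zero S isTreeSet V V-isMax) U U-isMax w sw
  where open WithDecidableLetters Fin._≟_
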